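{- Let $n\geq 2$ and let $l=3^m l_1$ be a positive integer with $l_1\geq 2$, $\gcd(3,l_1)=1$ and $m\geq 0$. Then $$\varepsilon(n,l)=\begin{cases} n^{3l}-n^l-\pi_n(3l) & \text{if } l_1 \text{ is odd},\\ n^{3l}+n^{l/2}\left(\pi_n(l)+1\right)-n^l-\pi_n(3l)-n^{3l/2} & \text{if } l_1 \text{ is even}.\end{cases}$$
   Context: A nonempty word $u$ is primitive if $u=v^m$ with $m$ a positive integer implies $m=1$; $|u|$ is the length of $u$. $\pi_n(k)$ denotes the number of primitive words of length $k$ over an alphabet of size $n$. $\varepsilon(n,l)$ is the number of pairs $(p,q)$ of primitive words over an alphabet of size $n$ with $|p|=2|q|=2l$ and $pq$ not primitive. -}

module Defs where

open import Data.Nat using (ℕ; zero; suc; _<_; _*_)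
open import Data.Fin using (Fin)
open import Data.List using (List; []; _++_; concat; replicate; length)
open import Data.List.Membership.Propositional using (_∈_)
open import Data.List.Relation.Unary.Unique.Propositional using (Unique)
open import Data.Product using (Σ; _×_; _,_)
open import Function.Bundles using (_⇔_)
open import Relation.Binary.PropositionalEquality using (_≡_; _≢_)
open import Relation.Nullary using (¬_)

Word : ℕ → Set
Word n = List (Fin n)

_^ʷ_ : ∀ {n} → Word n → ℕ → Word n
v ^ʷ m = concat (replicate m v)

Primitive : ∀ {n} → Word n → Set
Primitive {n} u = (u ≢ []) × (∀ (v : Word n) (m : ℕ) → 0 < m → u ≡ v ^ʷ m → m ≡ 1)

-- "The number of x : A satisfying P is N": an explicit duplicate-free list
-- enumerating exactly the elements satisfying P, of length N.
HasCount : {A : Set} → (A → Set) → ℕ → Set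
HasCount {A} P N = Σ (List A) λ xs → Unique xs × (∀ x → (x ∈ xs) ⇔ P x) × (length xs ≡ N)

-- primitive words of length k over an alphabet of size n (counted by π_n(k))
PrimOfLength : (n k : ℕ) → Word n → Set
PrimOfLength n k u = (length u ≡ k) × Primitive u

-- pairs (p,q) of primitive words, |p| = 2|q| = 2l, pq not primitive (counted by ε(n,l))
EpsPair : (n l : ℕ) → Word n × Word n → Set
EpsPair n l (p , q) = PrimOfLength n (2 * l) p × PrimOfLength n l q × ¬ Primitive (p ++ q)

module Submission where

-- A word u of length 3l splits as u = p q with |p| = 2l and |q| = l, and the n^(3l) such words
-- fall into four disjoint classes: primitive words (π_n(3l) of them); non-primitive u with p and
-- q primitive (ε(n,l), via (p , q) ↦ p q); words of period l, i.e. cubes (n^l); and the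
-- remaining exceptional words. For an exceptional u, a proper period D of u together with a
-- proper period of p or of q yields, by Fine and Wilf, a period of u dividing l, unless D = 3l/2
-- and q is not primitive. So exceptional words are squares x x with |x| = 3l/2, and there are
-- none for odd l. For l = 2h they correspond to the words x of length 3h without period h whose
-- suffix of length 2h is not primitive; sorting the n^(3h) words of length 3h by that suffix
-- shows there are n^(3h) − n^h π_n(2h) − n^h of them.

module WordCounting where

  open import Data.Empty using (⊥-elim)
  open import Data.Fin using (Fin)
  import Data.Fin.Properties as Fin
  open import Data.List using (List; []; _∷_; _++_; length; take; drop; map; cartesianProduct; allFin; filter)
  open import Data.List.Membership.Propositional using (_∈_)
  open import Data.List.Membership.Propositional.Properties
    using ( ∈-map⁺; ∈-map⁻; ∈-cartesianProduct⁺; ∈-cartesianProduct⁻; ∈-filter⁺; ∈-filter⁻; ∈-allFin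
          ; ∈-++⁺ˡ; ∈-++⁺ʳ; ∈-++⁻)
  open import Data.List.Membership.Propositional.Properties.WithK using (unique∧set⇒bag)
  open import Data.List.Properties
    using ( length-++; length-map; length-tabulate; length-take; length-drop; take++drop≡id; ++-identityʳ
          ; ∷-injectiveˡ; ∷-injectiveʳ)
  open import Data.List.Relation.Binary.BagAndSetEquality using (∼bag⇒↭)
  open import Data.List.Relation.Binary.Permutation.Propositional.Properties using (↭-length)
  open import Data.List.Relation.Unary.All as All using (All)
  open import Data.List.Relation.Unary.Any using (here; there)
  open import Data.List.Relation.Unary.Unique.Propositional using (Unique; []; _∷_)
  import Data.List.Relation.Unary.Unique.Propositional.Properties as Unique
  open import Data.Maybe using (Maybe; just; nothing)
  import Data.Maybe.Properties as Maybe
  open import Data.Nat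
  open import Data.Nat.Coprimality using (Coprime; coprime-divisor; gcd≡1⇒coprime)
  open import Data.Nat.DivMod
  open import Data.Nat.Divisibility
  open import Data.Nat.Induction using (<-wellFounded)
  open import Data.Nat.Properties
  open import Data.Nat.Tactic.RingSolver using (solve; solve-∀)
  open import Data.Product using (∃; ∃-syntax; _×_; _,_; proj₁; proj₂; uncurry)
  open import Data.Sum using (inj₁; inj₂; [_,_])
  open import Data.Unit using (⊤; tt)
  open import Function using (_∘_; _⇔_; mk⇔; Equivalence)
  open import Induction.WellFounded using (Acc; acc)
  open import Relation.Binary using (DecidableEquality; tri<; tri≈; tri>)
  open import Relation.Binary.PropositionalEquality hiding ([_])
  open import Relation.Nullary using (Dec; yes; no; ¬_; contradiction)
  open import Relation.Nullary.Decidable using (map′; _×-dec_; _→-dec_; ¬?; decidable-stable)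
  open import Relation.Unary using (_∪_; _∩_; _≐_; Empty; Decidable)

  open import Defs

  private variable
    A B : Set
    f : ℕ → B
    L d n N a b : ℕ
    P Q : A → Set


  -- Periodic sequences and the theorem of Fine and Wilf

  Periodic : (ℕ → B) → ℕ → ℕ → Set
  Periodic f L d = ∀ i → i + d < L → f i ≡ f (i + d)

  periodic-* : Periodic f L d → ∀ k → Periodic f L (k * d)
  periodic-* {f = f} P zero i _ = cong f (sym (+-identityʳ i))
  periodic-* {f = f} {L} {d} P (suc k) i i+[d+kd]<L = begin
    f i             ≡⟨ periodic-* P k i (≤-<-trans (+-monoʳ-≤ i (m≤n+m (k * d) d)) i+[d+kd]<L) ⟩
    f (i + k * d)   ≡⟨ P (i + k * d) (subst (_< L) (sym i+kd+d≡) i+[d+kd]<L) ⟩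
    f (i + k * d + d) ≡⟨ cong f i+kd+d≡ ⟩
    f (i + (d + k * d)) ∎
    where
    open ≡-Reasoning
    i+kd+d≡ : i + k * d + d ≡ i + (d + k * d)
    i+kd+d≡ = trans (+-assoc i (k * d) d) (cong (i +_) (+-comm (k * d) d))

  periodic-∣ : ∀ {e} → d ∣ e → Periodic f L d → Periodic f L e
  periodic-∣ (divides k refl) P = periodic-* P k

  periodic-% : .{{_ : NonZero d}} → Periodic f L d → ∀ {x} → x < L → f x ≡ f (x % d)
  periodic-% {d = d} {f = f} {L} P {x} x<L = sym (begin
    f (x % d)               ≡⟨ periodic-* P (x / d) (x % d) (subst (_< L) (m≡m%n+[m/n]*n x d) x<L) ⟩
    f (x % d + x / d * d)   ≡⟨ cong f (sym (m≡m%n+[m/n]*n x d)) ⟩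
    f x                     ∎)
    where open ≡-Reasoning

  periodic-≡% : .{{_ : NonZero d}} → Periodic f L d → ∀ {x y} → x < L → y < L → x % d ≡ y % d → f x ≡ f y
  periodic-≡% {f = f} P x<L y<L x≡y = trans (periodic-% P x<L) (trans (cong f x≡y) (sym (periodic-% P y<L)))

  periodic-≤ : ∀ {L′} → L′ ≤ L → Periodic f L d → Periodic f L′ d
  periodic-≤ L′≤L P i i+d<L′ = P i (<-≤-trans i+d<L′ L′≤L)

  periodic-shift : ∀ s {L′} → s + L′ ≤ L → Periodic f L d → Periodic (f ∘ (s +_)) L′ d
  periodic-shift {f = f} {d = d} s {L′} s+L′≤L P i i+d<L′ =
    trans (P (s + i) s+i+d<L) (cong f (+-assoc s i d))
    where
    s+i+d<L = <-≤-trans (subst (_< s + L′) (sym (+-assoc s i d)) (+-monoʳ-< s i+d<L′)) s+L′≤L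

  periodic-cong : ∀ {g : ℕ → B} → (∀ {i} → i < L → f i ≡ g i) → Periodic f L d → Periodic g L d
  periodic-cong {d = d} f≗g P i i+d<L =
    trans (sym (f≗g (≤-<-trans (m≤m+n i d) i+d<L))) (trans (P i i+d<L) (f≗g i+d<L))

  -- Each x < L has a representative s + rep x ≡ x (mod p) in the window; as r ∣ p,
  -- rep i and rep (i + r) are congruent mod r, where the window has period r.
  periodic-lift : ∀ {L p r} s {L′} .{{_ : NonZero p}} .{{_ : NonZero r}} → r ∣ p → p ≤ L′ → s + L′ ≤ L →
                  Periodic f L p → Periodic (f ∘ (s +_)) L′ r → Periodic f L r
  periodic-lift {f = f} {L} {p@(suc p′)} {r} s {L′} r∣p p≤L′ s+L′≤L Pₚ Pᵣ i i+r<L = begin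
    f i                   ≡⟨ periodic-≡% Pₚ i<L (in-range i) (sym (s+rep≡ i)) ⟩
    f (s + rep i)         ≡⟨ periodic-≡% Pᵣ (rep<L′ i) (rep<L′ (i + r)) rep≡ ⟩
    f (s + rep (i + r))   ≡⟨ periodic-≡% Pₚ (in-range (i + r)) i+r<L (s+rep≡ (i + r)) ⟩
    f (i + r)             ∎
    where
    open ≡-Reasoning
    rep : ℕ → ℕ
    rep x = (x + p′ * s) % p
    rep<L′ : ∀ x → rep x < L′
    rep<L′ x = <-≤-trans (m%n<n (x + p′ * s) p) p≤L′
    in-range : ∀ x → s + rep x < L
    in-range x = <-≤-trans (+-monoʳ-< s (rep<L′ x)) s+L′≤L
    i<L : i < L
    i<L = ≤-<-trans (m≤m+n i r) i+r<L
    s+rep≡ : ∀ x → (s + rep x) % p ≡ x % p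
    s+rep≡ x = begin
      (s + rep x) % p                   ≡⟨ %-distribˡ-+ s (rep x) p ⟩
      (s % p + rep x % p) % p           ≡⟨ cong (λ y → (s % p + y) % p) (m%n%n≡m%n (x + p′ * s) p) ⟩
      (s % p + (x + p′ * s) % p) % p    ≡⟨ sym (%-distribˡ-+ s (x + p′ * s) p) ⟩
      (s + (x + p′ * s)) % p            ≡⟨ cong (_% p) (shuffle s x p′) ⟩
      (x + s * p) % p                   ≡⟨ [m+kn]%n≡m%n x s p ⟩
      x % p                             ∎
      where
      shuffle : ∀ s x p′ → s + (x + p′ * s) ≡ x + s * suc p′
      shuffle = solve-∀
    rep%r : ∀ x → rep x % r ≡ (x + p′ * s) % r
    rep%r x = m∣n⇒o%n%m≡o%m r p (x + p′ * s) r∣p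
    rep≡ : rep i % r ≡ rep (i + r) % r
    rep≡ = begin
      rep i % r                 ≡⟨ rep%r i ⟩
      (i + p′ * s) % r          ≡⟨ sym ([m+n]%n≡m%n (i + p′ * s) r) ⟩
      (i + p′ * s + r) % r      ≡⟨ cong (_% r) (shuffle i r (p′ * s)) ⟩
      (i + r + p′ * s) % r      ≡⟨ sym (rep%r (i + r)) ⟩
      rep (i + r) % r           ∎
      where
      shuffle : ∀ i r t → i + t + r ≡ i + r + t
      shuffle = solve-∀

  CommonPeriod : (ℕ → B) → ℕ → ℕ → ℕ → Set
  CommonPeriod f L p q = ∃[ r ] 0 < r × r ∣ p × r ∣ q × Periodic f L r

  private
    split-< : ∀ {p q} → p < q → ∃[ t ] 0 < t × q ≡ p + t
    split-< {p} {q} p<q = q ∸ p , m<n⇒0<n∸m p<q , sym (m+[n∸m]≡n (<⇒≤ p<q))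

    -- Euclid's subtraction step: periods p and p + t on [0, L) give period t on [0, L ∸ p).
    fine-wilf-reduce : ∀ {L p t c} → 0 < p → 0 < t → c ∣ p → c ∣ t → p + (p + t) ≤ L + c →
      Periodic f L p → Periodic f L (p + t) →
      (p + t ≤ (L ∸ p) + c → Periodic f (L ∸ p) p → Periodic f (L ∸ p) t → CommonPeriod f (L ∸ p) p t) →
      CommonPeriod f L p (p + t)
    fine-wilf-reduce {f = f} {L} {p} {t} {c} 0<p 0<t c∣p c∣t bound Pₚ Pₚ₊ₜ recurse =
      lift (recurse bound′ (periodic-≤ L′≤L Pₚ) Pₜ)
      where
      L′ = L ∸ p
      L′≤L : L′ ≤ L
      L′≤L = m∸n≤m L p
      p+p+c≤L+c : p + p + c ≤ L + c
      p+p+c≤L+c = ≤-trans (≤-reflexive (+-assoc p p c))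
                          (≤-trans (+-monoʳ-≤ p (+-monoʳ-≤ p (∣⇒≤ {{>-nonZero 0<t}} c∣t))) bound)
      p+p≤L : p + p ≤ L
      p+p≤L = +-cancelʳ-≤ c (p + p) L p+p+c≤L+c
      p+L′≡L : p + L′ ≡ L
      p+L′≡L = m+[n∸m]≡n (≤-trans (m≤m+n p p) p+p≤L)
      p≤L′ : p ≤ L′
      p≤L′ = +-cancelˡ-≤ p p L′ (subst (p + p ≤_) (sym p+L′≡L) p+p≤L)
      bound′ : p + t ≤ L′ + c
      bound′ = +-cancelˡ-≤ p (p + t) (L′ + c)
                 (subst (p + (p + t) ≤_) (trans (cong (_+ c) (sym p+L′≡L)) (+-assoc p L′ c)) bound)
      Pₜ : Periodic f L′ t
      Pₜ i i+t<L′ = trans (Pₚ₊ₜ i i+[p+t]<L) (trans (cong f (i+[p+t]≡ i)) (sym (Pₚ (i + t) i+t+p<L)))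
        where
        i+[p+t]≡ : ∀ i → i + (p + t) ≡ i + t + p
        i+[p+t]≡ i = trans (cong (i +_) (+-comm p t)) (sym (+-assoc i t p))
        i+[p+t]<L : i + (p + t) < L
        i+[p+t]<L = subst (_< L) (trans (sym (+-assoc p i t)) (trans (cong (_+ t) (+-comm p i)) (+-assoc i p t)))
                      (subst (p + (i + t) <_) p+L′≡L (+-monoʳ-< p i+t<L′))
        i+t+p<L : i + t + p < L
        i+t+p<L = subst (_< L) (i+[p+t]≡ i) i+[p+t]<L
      lift : CommonPeriod f L′ p t → CommonPeriod f L p (p + t)
      lift (r , 0<r , r∣p , r∣t , Pᵣ) = r , 0<r , r∣p , ∣m∣n⇒∣m+n r∣p r∣t ,
        periodic-lift 0 {{>-nonZero 0<p}} {{>-nonZero 0<r}} r∣p p≤L′ L′≤L Pₚ Pᵣ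

    fine-wilf-acc : ∀ {L p q c} → Acc _<_ (p + q) → 0 < p → 0 < q → 0 < c → c ∣ p → c ∣ q → p + q ≤ L + c →
                    Periodic f L p → Periodic f L q → CommonPeriod f L p q
    fine-wilf-acc {L = L} {p = p} {q = q} {c = c} (acc rec) 0<p 0<q 0<c c∣p c∣q bound Pp Pq with <-cmp p q
    ... | tri≈ _ refl _ = p , 0<p , ∣-refl , ∣-refl , Pp
    ... | tri< p<q _ _ with t , 0<t , refl ← split-< p<q =
      fine-wilf-reduce 0<p 0<t c∣p c∣t bound Pp Pq
        (fine-wilf-acc (rec (m<n+m (p + t) 0<p)) 0<p 0<t 0<c c∣p c∣t)
      where c∣t = ∣m+n∣m⇒∣n c∣q c∣p
    ... | tri> _ _ q<p with t , 0<t , refl ← split-< q<p =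
      swap (fine-wilf-reduce 0<q 0<t c∣q c∣t (subst (_≤ L + c) (+-comm p q) bound) Pq Pp
             (fine-wilf-acc (rec (m<m+n (q + t) 0<q)) 0<q 0<t 0<c c∣q c∣t))
      where
      c∣t = ∣m+n∣m⇒∣n c∣p c∣q
      swap : ∀ {L p q} → CommonPeriod f L p q → CommonPeriod f L q p
      swap (r , 0<r , r∣p , r∣q , Pᵣ) = r , 0<r , r∣q , r∣p , Pᵣ

  -- Fine and Wilf's theorem, with an arbitrary common divisor c in place of gcd p q.
  fine-wilf : ∀ {L p q c} → 0 < p → 0 < q → 0 < c → c ∣ p → c ∣ q → p + q ≤ L + c →
              Periodic f L p → Periodic f L q → CommonPeriod f L p q
  fine-wilf = fine-wilf-acc (<-wellFounded _)

  BoundedCommonDivisor : ℕ → ℕ → ℕ → Set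
  BoundedCommonDivisor e D L = ∃[ c ] 0 < c × c ∣ e × c ∣ D × e + D ≤ L + c

  coprime-solution : ∀ {a b x y} .{{_ : NonZero a}} → Coprime a b → a * y ≡ b * x →
                     ∃[ c ] x ≡ a * c × y ≡ b * c
  coprime-solution {a} {b} {x} {y} coprime ay≡bx
    with divides c x≡ca ← coprime-divisor coprime (divides y (trans (sym ay≡bx) (*-comm a y)))
    = c , x≡ac , *-cancelˡ-≡ y (b * c) a (begin
      a * y         ≡⟨ ay≡bx ⟩
      b * x         ≡⟨ cong (b *_) x≡ac ⟩
      b * (a * c)   ≡⟨ solve (a ∷ b ∷ c ∷ []) ⟩
      a * (b * c)   ∎)
    where
    open ≡-Reasoning
    x≡ac = trans x≡ca (*-comm c a)

  private
    exact-bound : ∀ a b j {e D L} .{{_ : NonZero a}} → Coprime a b → a + b ≡ j * a + 1 →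
                  a * D ≡ b * e → L ≡ j * e → 0 < e → BoundedCommonDivisor e D L
    exact-bound a b j coprime a+b≡ aD≡be refl 0<e with c , refl , refl ← coprime-solution coprime aD≡be =
      c , >-nonZero⁻¹ c {{m*n≢0⇒n≢0 a {{>-nonZero 0<e}}}} , n∣m*n a , n∣m*n b , ≤-reflexive (begin
        a * c + b * c         ≡⟨ sym (*-distribʳ-+ c a b) ⟩
        (a + b) * c           ≡⟨ cong (_* c) a+b≡ ⟩
        (j * a + 1) * c       ≡⟨ solve (j ∷ a ∷ c ∷ []) ⟩
        j * (a * c) + c       ∎)
      where open ≡-Reasoning

    -- Here c = 1 suffices, because 1/a + 3/b ≤ 1.
    small-bound : ∀ a b {e D L} .{{_ : NonZero a}} .{{_ : NonZero b}} → b + 3 * a ≤ a * b →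
                  a * e ≤ L → b * D ≤ 3 * L → BoundedCommonDivisor e D L
    small-bound a b {e} {D} {L} ab≥ ae≤L bD≤3L =
      1 , s≤s z≤n , 1∣ e , 1∣ D , ≤-trans e+D≤L (m≤m+n L 1)
      where
      open ≤-Reasoning
      e+D≤L : e + D ≤ L
      e+D≤L = *-cancelˡ-≤ (a * b) {{m*n≢0 a b}} (begin
        a * b * (e + D)             ≡⟨ solve (a ∷ b ∷ e ∷ D ∷ []) ⟩
        b * (a * e) + a * (b * D)   ≤⟨ +-mono-≤ (*-monoʳ-≤ b ae≤L) (*-monoʳ-≤ a bD≤3L) ⟩
        b * L + a * (3 * L)         ≡⟨ solve (a ∷ b ∷ L ∷ []) ⟩
        (b + 3 * a) * L             ≤⟨ *-monoˡ-≤ L ab≥ ⟩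
        a * b * L                   ∎)

    *-≤-cofactor : ∀ {a m} x {y} → a ≤ m → y ≡ m * x → a * x ≤ y
    *-≤-cofactor x a≤m refl = *-monoˡ-≤ x a≤m

  -- D = 3L/(3 + k) and e = L/(2 + j) always leave room for Fine and Wilf.
  bounded-common-divisor : ∀ k j {L D e} → 3 * L ≡ (3 + k) * D → L ≡ (2 + j) * e → 0 < e →
                           BoundedCommonDivisor e D L
  bounded-common-divisor 0 j {L} {D} {e} 3L≡3D L≡ 0<e =
    e , 0<e , ∣-refl , divides (2 + j) (trans D≡L L≡) , ≤-reflexive (trans (+-comm e D) (cong (_+ e) D≡L))
    where D≡L = *-cancelˡ-≡ D L 3 (sym 3L≡3D)
  bounded-common-divisor 1 0 {L} {D} {e} 3L≡4D L≡2e 0<e =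
    exact-bound 2 3 2 (gcd≡1⇒coprime refl) refl (*-cancelˡ-≡ (2 * D) (3 * e) 2 (begin
      2 * (2 * D)   ≡⟨ solve (D ∷ []) ⟩
      4 * D         ≡⟨ sym 3L≡4D ⟩
      3 * L         ≡⟨ cong (3 *_) L≡2e ⟩
      3 * (2 * e)   ≡⟨ solve (e ∷ []) ⟩
      2 * (3 * e)   ∎)) L≡2e 0<e
    where open ≡-Reasoning
  bounded-common-divisor 1 1 {L} {D} {e} 3L≡4D L≡3e 0<e =
    exact-bound 4 9 3 (gcd≡1⇒coprime refl) refl (begin
      4 * D         ≡⟨ sym 3L≡4D ⟩
      3 * L         ≡⟨ cong (3 *_) L≡3e ⟩
      3 * (3 * e)   ≡⟨ solve (e ∷ []) ⟩
      9 * e         ∎) L≡3e 0<e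
    where open ≡-Reasoning
  bounded-common-divisor 1 (suc (suc j)) {D = D} {e} 3L≡4D L≡ _ =
    small-bound 4 4 ≤-refl (*-≤-cofactor e (m≤m+n 4 j) L≡) (*-≤-cofactor D (≤-refl {4}) 3L≡4D)
  bounded-common-divisor 2 0 {L} {D} {e} 3L≡5D L≡2e 0<e =
    exact-bound 5 6 2 (gcd≡1⇒coprime refl) refl (begin
      5 * D         ≡⟨ sym 3L≡5D ⟩
      3 * L         ≡⟨ cong (3 *_) L≡2e ⟩
      3 * (2 * e)   ≡⟨ solve (e ∷ []) ⟩
      6 * e         ∎) L≡2e 0<e
    where open ≡-Reasoning
  bounded-common-divisor 2 (suc j) {D = D} {e} 3L≡5D L≡ _ =
    small-bound 3 5 (m≤m+n 14 1) (*-≤-cofactor e (m≤m+n 3 j) L≡) (*-≤-cofactor D (≤-refl {5}) 3L≡5D)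
  bounded-common-divisor (suc (suc (suc k))) j {D = D} {e} 3L≡ L≡ _ =
    small-bound 2 6 ≤-refl (*-≤-cofactor e (m≤m+n 2 j) L≡) (*-≤-cofactor D (m≤m+n 6 k) 3L≡)

  at : List A → ℕ → Maybe A
  at []       _       = nothing
  at (x ∷ _)  zero    = just x
  at (_ ∷ xs) (suc i) = at xs i

  at-extensionality : (xs ys : List A) → (∀ i → at xs i ≡ at ys i) → xs ≡ ys
  at-extensionality []       []       _  = refl
  at-extensionality []       (_ ∷ _)  eq with () ← eq 0
  at-extensionality (_ ∷ _)  []       eq with () ← eq 0
  at-extensionality (x ∷ xs) (y ∷ ys) eq with refl ← eq 0 =
    cong (x ∷_) (at-extensionality xs ys (eq ∘ suc))

  at-beyond : (xs : List A) {i : ℕ} → length xs ≤ i → at xs i ≡ nothing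
  at-beyond []                   _         = refl
  at-beyond (_ ∷ xs) {suc i} (s≤s |xs|≤i) = at-beyond xs |xs|≤i

  at-++ˡ : (xs {ys} : List A) {i : ℕ} → i < length xs → at (xs ++ ys) i ≡ at xs i
  at-++ˡ (_ ∷ _)  {i = zero}  _          = refl
  at-++ˡ (_ ∷ xs) {i = suc i} (s≤s i<xs) = at-++ˡ xs i<xs

  at-++ʳ : (xs ys : List A) (j : ℕ) → at (xs ++ ys) (length xs + j) ≡ at ys j
  at-++ʳ []       ys j = refl
  at-++ʳ (_ ∷ xs) ys j = at-++ʳ xs ys j

  at-take : (xs : List A) {k i : ℕ} → i < k → at (take k xs) i ≡ at xs i
  at-take []       {suc k}         _         = refl
  at-take (_ ∷ _)  {suc k} {zero}  _         = refl
  at-take (_ ∷ xs) {suc k} {suc i} (s≤s i<k) = at-take xs i<k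

  at-drop : (xs : List A) (k i : ℕ) → at (drop k xs) i ≡ at xs (k + i)
  at-drop xs       zero    i = refl
  at-drop []       (suc k) i = refl
  at-drop (_ ∷ xs) (suc k) i = at-drop xs k i

  length-take-≤ : (xs : List A) {k : ℕ} → k ≤ length xs → length (take k xs) ≡ k
  length-take-≤ xs {k} k≤ = trans (length-take k xs) (m≤n⇒m⊓n≡m k≤)

  ++-injective : (xs ys : List A) {zs ws : List A} → length xs ≡ length ys → xs ++ zs ≡ ys ++ ws → xs ≡ ys × zs ≡ ws
  ++-injective []       []       _      eq = refl , eq
  ++-injective (x ∷ xs) (y ∷ ys) |xs|≡ eq with refl ← ∷-injectiveˡ eq
    with refl , refl ← ++-injective xs ys (suc-injective |xs|≡) (∷-injectiveʳ eq) = refl , refl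

  take-++ : (xs ys : List A) → take (length xs) (xs ++ ys) ≡ xs
  take-++ []       ys = refl
  take-++ (x ∷ xs) ys = cong (x ∷_) (take-++ xs ys)

  drop-++ : (xs ys : List A) (k : ℕ) → drop (length xs + k) (xs ++ ys) ≡ drop k ys
  drop-++ []       ys k = refl
  drop-++ (_ ∷ xs) ys k = drop-++ xs ys k

  length-drop-+ : (xs : List A) {a b : ℕ} → length xs ≡ a + b → length (drop a xs) ≡ b
  length-drop-+ xs {a} {b} |xs|≡ = trans (length-drop a xs) (trans (cong (_∸ a) |xs|≡) (m+n∸m≡n a b))

  nonempty : {xs : List A} {k : ℕ} → length xs ≡ k → 0 < k → xs ≢ []
  nonempty refl () refl

  length-take+drop : (u : List A) (a : ℕ) → length u ≡ length (take a u) + length (drop a u)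
  length-take+drop u a = trans (cong length (sym (take++drop≡id a u))) (length-++ (take a u))

  length-^ʷ : (v : Word n) (m : ℕ) → length (v ^ʷ m) ≡ m * length v
  length-^ʷ v zero    = refl
  length-^ʷ v (suc m) = trans (length-++ v) (cong (length v +_) (length-^ʷ v m))

  at-^ʷ : ∀ {d} (v : Word n) m {i} .{{_ : NonZero d}} → length v ≡ d → i < m * d →
          at (v ^ʷ m) i ≡ at v (i % d)
  at-^ʷ v (suc m) {i} refl i<[1+m]d with i <? length v
  ... | yes i<d = trans (at-++ˡ v i<d) (cong (at v) (sym (m<n⇒m%n≡m i<d)))
  ... | no  i≮d with j , refl ← m≤n⇒∃[o]m+o≡n (≮⇒≥ i≮d) = begin
    at (v ++ v ^ʷ m) (length v + j)   ≡⟨ at-++ʳ v (v ^ʷ m) j ⟩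
    at (v ^ʷ m) j                     ≡⟨ at-^ʷ v m refl (+-cancelˡ-< (length v) j (m * length v) i<[1+m]d) ⟩
    at v (j % length v)               ≡⟨ cong (at v) (sym (%-remove-+ˡ j (∣-refl {length v}))) ⟩
    at v ((length v + j) % length v)  ∎
    where open ≡-Reasoning

  HasPeriod : List A → ℕ → Set
  HasPeriod u = Periodic (at u) (length u)

  ^ʷ-hasPeriod : (v : Word n) (m : ℕ) → HasPeriod (v ^ʷ m) (length v)
  ^ʷ-hasPeriod []      m i _ = cong (at ([] ^ʷ m)) (sym (+-identityʳ i))
  ^ʷ-hasPeriod v@(_ ∷ _) m i i+d<|vᵐ| = begin
    at (v ^ʷ m) i                          ≡⟨ at-^ʷ v m refl (≤-<-trans (m≤m+n i (length v)) i+d<md) ⟩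
    at v (i % length v)                    ≡⟨ cong (at v) (sym ([m+n]%n≡m%n i (length v))) ⟩
    at v ((i + length v) % length v)       ≡⟨ sym (at-^ʷ v m refl i+d<md) ⟩
    at (v ^ʷ m) (i + length v)             ∎
    where
    open ≡-Reasoning
    i+d<md = subst (i + length v <_) (length-^ʷ v m) i+d<|vᵐ|

  hasPeriod⇒≡^ʷ : ∀ {d} (u : Word n) m .{{_ : NonZero d}} → length u ≡ m * d → HasPeriod u d →
                  u ≡ take d u ^ʷ m
  hasPeriod⇒≡^ʷ []      zero    _ _ = refl
  hasPeriod⇒≡^ʷ {d = d} u (suc m) |u|≡ P = at-extensionality u (take d u ^ʷ suc m) at-u≡
    where
    |take|≡d : length (take d u) ≡ d
    |take|≡d = length-take-≤ u (subst (d ≤_) (sym |u|≡) (m≤m+n d (m * d)))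
    at-u≡ : ∀ i → at u i ≡ at (take d u ^ʷ suc m) i
    at-u≡ i with i <? length u
    ... | yes i<|u| = begin
      at u i                         ≡⟨ periodic-% P i<|u| ⟩
      at u (i % d)                   ≡⟨ sym (at-take u (m%n<n i d)) ⟩
      at (take d u) (i % d)          ≡⟨ sym (at-^ʷ (take d u) (suc m) |take|≡d (subst (i <_) |u|≡ i<|u|)) ⟩
      at (take d u ^ʷ suc m) i       ∎
      where open ≡-Reasoning
    ... | no  i≮|u| = trans (at-beyond u (≮⇒≥ i≮|u|))
      (sym (at-beyond (take d u ^ʷ suc m) (subst (_≤ i) (|vᵐ|≡ ) (≮⇒≥ i≮|u|))))
      where
      |vᵐ|≡ : length u ≡ length (take d u ^ʷ suc m)
      |vᵐ|≡ = trans |u|≡ (sym (trans (length-^ʷ (take d u) (suc m)) (cong (suc m *_) |take|≡d)))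

  take-hasPeriod⁻ : (u : List A) {k d : ℕ} → k ≤ length u → HasPeriod (take k u) d → Periodic (at u) k d
  take-hasPeriod⁻ u {k} {d} k≤|u| P =
    periodic-cong (at-take u) (subst (λ L → Periodic (at (take k u)) L d) (length-take-≤ u k≤|u|) P)

  drop-hasPeriod⁻ : (u : List A) {s d : ℕ} → HasPeriod (drop s u) d → Periodic (at u ∘ (s +_)) (length u ∸ s) d
  drop-hasPeriod⁻ u {s} {d} P =
    periodic-cong (λ {i} _ → at-drop u s i) (subst (λ L → Periodic (at (drop s u)) L d) (length-drop s u) P)

  take-hasPeriod⁺ : (u : List A) {k d : ℕ} → k ≤ length u → HasPeriod u d → HasPeriod (take k u) d
  take-hasPeriod⁺ u {k} {d} k≤|u| P = subst (λ L → Periodic (at (take k u)) L d) (sym (length-take-≤ u k≤|u|))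
    (periodic-cong (sym ∘ at-take u) (periodic-≤ k≤|u| P))

  drop-hasPeriod⁺ : (u : List A) {s d : ℕ} → s ≤ length u → HasPeriod u d → HasPeriod (drop s u) d
  drop-hasPeriod⁺ u {s} {d} s≤|u| P = subst (λ L → Periodic (at (drop s u)) L d) (sym (length-drop s u))
    (periodic-cong (λ {i} _ → sym (at-drop u s i))
      (periodic-shift s (≤-reflexive (m+[n∸m]≡n s≤|u|)) P))

  ProperPeriod : List A → ℕ → Set
  ProperPeriod u d = 0 < d × (∃[ m ] length u ≡ (2 + m) * d) × HasPeriod u d

  properPeriod⇒¬primitive : {u : Word n} {d : ℕ} → ProperPeriod u d → ¬ Primitive u
  properPeriod⇒¬primitive {u = u} {d} (0<d , (m , |u|≡) , P) (_ , powers-trivial) =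
    contradiction (powers-trivial (take d u) (2 + m) (s≤s z≤n) (hasPeriod⇒≡^ʷ u (2 + m) {{>-nonZero 0<d}} |u|≡ P)) λ ()

  []^ʷ : ∀ k → [] ^ʷ k ≡ [] {A = Fin n}
  []^ʷ zero    = refl
  []^ʷ (suc k) = []^ʷ k

  ¬properPeriod⇒primitive : {u : Word n} → u ≢ [] → (∀ {d} → ¬ ProperPeriod u d) → Primitive u
  ¬properPeriod⇒primitive {u = u} u≢[] ¬proper = u≢[] , powers-trivial
    where
    powers-trivial : ∀ v m → 0 < m → u ≡ v ^ʷ m → m ≡ 1
    powers-trivial v        1             _ _  = refl
    powers-trivial []       (suc (suc m)) _ u≡ = ⊥-elim (u≢[] (trans u≡ ([]^ʷ m)))
    powers-trivial v@(_ ∷ _) (suc (suc m)) _ u≡ = ⊥-elim (¬proper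
      (s≤s z≤n , (m , trans (cong length u≡) (length-^ʷ v (2 + m))) ,
       subst (λ w → HasPeriod w (length v)) (sym u≡) (^ʷ-hasPeriod v (2 + m))))

  hasPeriod? : DecidableEquality A → (u : List A) (d : ℕ) → Dec (HasPeriod u d)
  hasPeriod? _≟_ u d = map′ (λ P i i+d<|u| → P (≤-<-trans (m≤m+n i d) i+d<|u|) i+d<|u|) (λ P {i} _ → P i)
    (allUpTo? (λ i → (i + d <? length u) →-dec Maybe.≡-dec _≟_ (at u i) (at u (i + d))) (length u))

  proper-cofactor : ∀ {d x} → d < x → d ∣ x → ∃[ m ] x ≡ (2 + m) * d
  proper-cofactor     d<x (divides 0             refl) = ⊥-elim (n≮0 d<x)
  proper-cofactor {d} d<x (divides 1             refl) = ⊥-elim (<-irrefl (sym (+-identityʳ d)) d<x)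
  proper-cofactor     d<x (divides (suc (suc m)) refl) = m , refl

  cofactor⇒< : ∀ {d x} m → 0 < d → x ≡ (2 + m) * d → d < x
  cofactor⇒< {d} m 0<d refl = m<m+n d (≤-trans 0<d (m≤m+n d _))

  properPeriod? : DecidableEquality A → (u : List A) → Dec (∃ (ProperPeriod u))
  properPeriod? _≟_ u = map′ toProper fromProper
    (anyUpTo? (λ d → (0 <? d) ×-dec (d ∣? length u) ×-dec hasPeriod? _≟_ u d) (length u))
    where
    toProper : ∃[ d ] d < length u × 0 < d × d ∣ length u × HasPeriod u d → ∃ (ProperPeriod u)
    toProper (d , d<|u| , 0<d , d∣|u| , P) = d , 0<d , proper-cofactor d<|u| d∣|u| , P
    fromProper : ∃ (ProperPeriod u) → ∃[ d ] d < length u × 0 < d × d ∣ length u × HasPeriod u d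
    fromProper (d , 0<d , (m , |u|≡) , P) = d , cofactor⇒< m 0<d |u|≡ , 0<d , divides (2 + m) |u|≡ , P

  primitive? : (u : Word n) → Dec (Primitive u)
  primitive? []        = no λ (u≢[] , _) → u≢[] refl
  primitive? u@(_ ∷ _) with properPeriod? Fin._≟_ u
  ... | yes (_ , proper) = no (properPeriod⇒¬primitive proper)
  ... | no  ¬proper      = yes (¬properPeriod⇒primitive (λ ()) (λ proper → ¬proper (_ , proper)))

  ¬primitive⇒properPeriod : {u : Word n} → u ≢ [] → ¬ Primitive u → ∃ (ProperPeriod u)
  ¬primitive⇒properPeriod {u = u} u≢[] ¬prim = decidable-stable (properPeriod? Fin._≟_ u)
    λ ¬proper → ¬prim (¬properPeriod⇒primitive u≢[] (λ proper → ¬proper (_ , proper)))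

  -- Non-primitive words of length 3l

  -- Fine and Wilf on the factor, then periodic-lift carries the common period back to u.
  factor-period : (u : List A) {D L s e : ℕ} (k j : ℕ) → HasPeriod u D → 0 < D → 3 * L ≡ (3 + k) * D →
                  s + L ≤ length u → Periodic (at u ∘ (s +_)) L e → 0 < e → L ≡ (2 + j) * e →
                  ∃[ r ] r ∣ L × r ∣ D × HasPeriod u r
  factor-period u {D} {L} {s} k j PD 0<D 3L≡ s+L≤|u| Pe 0<e L≡
    with c , 0<c , c∣e , c∣D , bound ← bounded-common-divisor k j 3L≡ L≡ 0<e
    with r , 0<r , r∣e , r∣D , Pr ← fine-wilf 0<e 0<D 0<c c∣e c∣D bound Pe (periodic-shift s s+L≤|u| PD)
    = r , ∣-trans r∣e (divides (2 + j) L≡) , r∣D ,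
      periodic-lift s {{>-nonZero 0<D}} {{>-nonZero 0<r}} r∣D D≤L s+L≤|u| PD Pr
    where
    D≤L : D ≤ L
    D≤L = *-cancelˡ-≤ 3 (subst (3 * D ≤_) (sym 3L≡) (*-monoˡ-≤ D (m≤m+n 3 k)))

  module _ {l : ℕ} {u : Word n} (|u|≡3l : length u ≡ 3 * l) where

    private
      2l≤|u| : 2 * l ≤ length u
      2l≤|u| = subst (2 * l ≤_) (sym |u|≡3l) (*-monoˡ-≤ l (m≤m+n 2 1))

      3l≡2l+l : 3 * l ≡ 2 * l + l
      3l≡2l+l = solve (l ∷ [])

      2l+l≤|u| : 2 * l + l ≤ length u
      2l+l≤|u| = ≤-reflexive (trans (sym 3l≡2l+l) (sym |u|≡3l))

      |u|∸2l≡l : length u ∸ 2 * l ≡ l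
      |u|∸2l≡l = trans (cong (_∸ 2 * l) (trans |u|≡3l 3l≡2l+l)) (m+n∸m≡n (2 * l) l)

    hasPeriod-from-prefix : ∀ {D e} → ProperPeriod u D → ProperPeriod (take (2 * l) u) e → HasPeriod u l
    hasPeriod-from-prefix {D} (0<D , (k , |u|≡) , PD) (0<e , (j , |p|≡) , Pe) =
      conclude (factor-period u (suc (2 * k)) j PD 0<D 3*2l≡ 2l≤|u| (take-hasPeriod⁻ u 2l≤|u| Pe) 0<e
                 (trans (sym (length-take-≤ u 2l≤|u|)) |p|≡))
      where
      open ≡-Reasoning
      3l≡ : 3 * l ≡ (2 + k) * D
      3l≡ = trans (sym |u|≡3l) |u|≡
      3*2l≡ : 3 * (2 * l) ≡ (3 + suc (2 * k)) * D
      3*2l≡ = begin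
        3 * (2 * l)           ≡⟨ solve (l ∷ []) ⟩
        2 * (3 * l)           ≡⟨ cong (2 *_) 3l≡ ⟩
        2 * ((2 + k) * D)     ≡⟨ solve (k ∷ D ∷ []) ⟩
        (3 + suc (2 * k)) * D ∎
      conclude : ∃[ r ] r ∣ 2 * l × r ∣ D × HasPeriod u r → HasPeriod u l
      conclude (r , r∣2l , r∣D , Pr) = periodic-∣ (∣m+n∣m⇒∣n r∣2l+l r∣2l) Pr
        where
        r∣2l+l : r ∣ 2 * l + l
        r∣2l+l = ∣-trans r∣D (divides (2 + k) (trans (sym 3l≡2l+l) 3l≡))

    hasPeriod-from-suffix : ∀ {D e} k → HasPeriod u D → 0 < D → 3 * l ≡ (3 + k) * D →
                            ProperPeriod (drop (2 * l) u) e → HasPeriod u l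
    hasPeriod-from-suffix k PD 0<D 3l≡ (0<e , (j , |q|≡) , Pe) =
      conclude (factor-period u k j PD 0<D 3l≡ 2l+l≤|u|
                 (subst (λ L → Periodic (at u ∘ (2 * l +_)) L _) |u|∸2l≡l (drop-hasPeriod⁻ u Pe)) 0<e
                 (trans (sym |u|∸2l≡l) (trans (sym (length-drop (2 * l) u)) |q|≡)))
      where
      conclude : ∃[ r ] r ∣ l × _ → HasPeriod u l
      conclude (r , r∣l , _ , Pr) = periodic-∣ r∣l Pr

    module _ (0<l : 0 < l) (¬prim : ¬ Primitive u) (¬per : ¬ HasPeriod u l) where

      private
        proper : ∃[ D ] ProperPeriod u D
        proper = ¬primitive⇒properPeriod (nonempty |u|≡3l (≤-trans 0<l (m≤n*m l 3))) ¬prim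

      prefix-primitive : Primitive (take (2 * l) u)
      prefix-primitive = decidable-stable (primitive? _) λ ¬primp →
        let _ , proper-p = ¬primitive⇒properPeriod (nonempty (length-take-≤ u 2l≤|u|) (≤-trans 0<l (m≤n*m l 2))) ¬primp
        in ¬per (hasPeriod-from-prefix (proj₂ proper) proper-p)

      ¬primitive-suffix⇒square : ¬ Primitive (drop (2 * l) u) → ∃[ D ] 2 * D ≡ 3 * l × HasPeriod u D
      ¬primitive-suffix⇒square ¬primq with proper
      ... | D , 0<D , (0 , |u|≡) , PD = D , trans (sym |u|≡) |u|≡3l , PD
      ... | D , 0<D , (suc k , |u|≡) , PD =
        let _ , proper-q = ¬primitive⇒properPeriod (nonempty (trans (length-drop (2 * l) u) |u|∸2l≡l) 0<l) ¬primq
        in ⊥-elim (¬per (hasPeriod-from-suffix k PD 0<D (trans (sym |u|≡3l) |u|≡) proper-q))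

  -- Counting with duplicate-free lists

  HasCount-unique : HasCount P a → HasCount P b → a ≡ b
  HasCount-unique (xs , unique-xs , ∈xs⇔ , refl) (ys , unique-ys , ∈ys⇔ , refl) =
    ↭-length (∼bag⇒↭ (unique∧set⇒bag unique-xs unique-ys λ {x} →
      mk⇔ (Equivalence.from (∈ys⇔ x) ∘ Equivalence.to (∈xs⇔ x))
          (Equivalence.from (∈xs⇔ x) ∘ Equivalence.to (∈ys⇔ x))))

  HasCount-cong : P ≐ Q → HasCount P a → HasCount Q a
  HasCount-cong (P⊆Q , Q⊆P) (xs , unique-xs , ∈xs⇔ , |xs|≡) =
    xs , unique-xs , (λ x → mk⇔ (P⊆Q ∘ Equivalence.to (∈xs⇔ x)) (Equivalence.from (∈xs⇔ x) ∘ Q⊆P)) , |xs|≡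

  HasCount-∅ : Empty P → HasCount P 0
  HasCount-∅ empty = [] , [] , (λ x → mk⇔ (λ ()) (⊥-elim ∘ empty x)) , refl

  HasCount-∪ : HasCount P a → HasCount Q b → Empty (P ∩ Q) → HasCount (P ∪ Q) (a + b)
  HasCount-∪ (xs , unique-xs , ∈xs⇔ , refl) (ys , unique-ys , ∈ys⇔ , refl) disjoint =
    xs ++ ys ,
    Unique.++⁺ unique-xs unique-ys (λ (x∈xs , x∈ys) → disjoint _ (to (∈xs⇔ _) x∈xs , to (∈ys⇔ _) x∈ys)) ,
    (λ x → mk⇔ ([ inj₁ ∘ to (∈xs⇔ x) , inj₂ ∘ to (∈ys⇔ x) ] ∘ ∈-++⁻ xs)
               [ ∈-++⁺ˡ ∘ from (∈xs⇔ x) , ∈-++⁺ʳ xs ∘ from (∈ys⇔ x) ]) ,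
    length-++ xs
    where open Equivalence

  Image : (A → B) → (A → Set) → B → Set
  Image f P y = ∃[ x ] P x × y ≡ f x

  private
    map⁺-injectiveOn : (f : A → B) {xs : List A} → Unique xs →
                       (∀ {x y} → x ∈ xs → y ∈ xs → f x ≡ f y → x ≡ y) → Unique (map f xs)
    map⁺-injectiveOn f []                 _   = []
    map⁺-injectiveOn f (x∉xs ∷ unique-xs) inj =
      All.tabulate fx≢ ∷ map⁺-injectiveOn f unique-xs (λ x∈ y∈ → inj (there x∈) (there y∈))
      where
      fx≢ : ∀ {v} → v ∈ map f _ → f _ ≢ v
      fx≢ v∈ fx≡v with z , z∈xs , refl ← ∈-map⁻ f v∈ =
        All.lookup x∉xs z∈xs (inj (here refl) (there z∈xs) fx≡v)

  HasCount-image : (f : A → B) → (∀ {x y} → P x → P y → f x ≡ f y → x ≡ y) →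
                   HasCount P a → HasCount (Image f P) a
  HasCount-image f inj (xs , unique-xs , ∈xs⇔ , |xs|≡) =
    map f xs ,
    map⁺-injectiveOn f unique-xs (λ x∈ y∈ → inj (to (∈xs⇔ _) x∈) (to (∈xs⇔ _) y∈)) ,
    (λ y → mk⇔ (λ y∈ → let x , x∈ , y≡ = ∈-map⁻ f y∈ in x , to (∈xs⇔ x) x∈ , y≡)
               (λ { (x , Px , refl) → ∈-map⁺ f (from (∈xs⇔ x) Px) })) ,
    trans (length-map f xs) |xs|≡
    where open Equivalence

  HasCount-× : HasCount P a → HasCount Q b → HasCount (λ (x , y) → P x × Q y) (a * b)
  HasCount-× (xs , unique-xs , ∈xs⇔ , refl) (ys , unique-ys , ∈ys⇔ , refl) =
    cartesianProduct xs ys ,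
    Unique.cartesianProduct⁺ unique-xs unique-ys ,
    (λ (x , y) → mk⇔ (λ xy∈ → let x∈ , y∈ = ∈-cartesianProduct⁻ xs ys xy∈
                               in to (∈xs⇔ x) x∈ , to (∈ys⇔ y) y∈)
                     (λ (Px , Qy) → ∈-cartesianProduct⁺ (from (∈xs⇔ x) Px) (from (∈ys⇔ y) Qy))) ,
    length-cartesianProduct xs ys
    where
    open Equivalence
    length-cartesianProduct : (xs : List A) (ys : List B) → length (cartesianProduct xs ys) ≡ length xs * length ys
    length-cartesianProduct []       ys = refl
    length-cartesianProduct (x ∷ xs) ys =
      trans (length-++ (map (x ,_) ys)) (cong₂ _+_ (length-map (x ,_) ys) (length-cartesianProduct xs ys))

  HasCount-∩ : HasCount P a → (Q? : Decidable Q) → ∃[ b ] HasCount (P ∩ Q) b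
  HasCount-∩ (xs , unique-xs , ∈xs⇔ , _) Q? =
    length (filter Q? xs) , filter Q? xs , Unique.filter⁺ Q? unique-xs ,
    (λ x → mk⇔ (λ x∈ → let x∈xs , Qx = ∈-filter⁻ Q? x∈ in to (∈xs⇔ x) x∈xs , Qx)
               (λ (Px , Qx) → ∈-filter⁺ Q? (from (∈xs⇔ x) Px) Qx)) ,
    refl
    where open Equivalence

  HasCount-Fin : ∀ n → HasCount (λ (_ : Fin n) → ⊤) n
  HasCount-Fin n =
    allFin n , Unique.allFin⁺ n , (λ i → mk⇔ (λ _ → tt) (λ _ → ∈-allFin i)) , length-tabulate (λ i → i)

  HasCount-words : ∀ n k → HasCount (λ (w : Word n) → length w ≡ k) (n ^ k)
  HasCount-words n zero    = [] ∷ [] , All.[] ∷ [] , empty-only , refl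
    where
    empty-only : (w : Word n) → (w ∈ [] ∷ []) ⇔ (length w ≡ 0)
    empty-only []      = mk⇔ (λ _ → refl) (λ _ → here refl)
    empty-only (_ ∷ _) = mk⇔ (λ { (here ()) ; (there ()) }) (λ ())
  HasCount-words n (suc k) =
    HasCount-cong ((λ { ((_ , _) , (_ , |v|≡k) , refl) → cong suc |v|≡k }) ,
                   (λ { {a ∷ v} |w|≡ → (a , v) , (tt , suc-injective |w|≡) , refl }))
      (HasCount-image (uncurry _∷_) (λ _ _ → ∷-injective) (HasCount-× (HasCount-Fin n) (HasCount-words n k)))
    where
    ∷-injective : ∀ {x y : Fin n × Word n} → uncurry _∷_ x ≡ uncurry _∷_ y → x ≡ y
    ∷-injective refl = refl

  HasCount-split : ∀ a {R : List A × List A → Set} → (∀ {p q} → R (p , q) → length p ≡ a) →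
                   HasCount R N → HasCount (λ u → R (take a u , drop a u)) N
  HasCount-split a {R} |p|≡a #R =
    HasCount-cong (image⊆ , ⊆image) (HasCount-image (uncurry _++_) injective #R)
    where
    injective : ∀ {x y} → R x → R y → uncurry _++_ x ≡ uncurry _++_ y → x ≡ y
    injective {p , q} {p′ , q′} Rx Ry eq
      with refl , refl ← ++-injective p p′ (trans (|p|≡a Rx) (sym (|p|≡a Ry))) eq = refl
    image⊆ : ∀ {u} → Image (uncurry _++_) R u → R (take a u , drop a u)
    image⊆ ((p , q) , Rpq , refl) = subst R (sym (cong₂ _,_ take≡ drop≡)) Rpq
      where
      take≡ : take a (p ++ q) ≡ p
      take≡ = subst (λ k → take k (p ++ q) ≡ p) (|p|≡a Rpq) (take-++ p q)
      drop≡ : drop a (p ++ q) ≡ q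
      drop≡ = subst (λ k → drop k (p ++ q) ≡ q) (trans (+-identityʳ (length p)) (|p|≡a Rpq))
                (drop-++ p q 0)
    ⊆image : ∀ {u} → R (take a u , drop a u) → Image (uncurry _++_) R u
    ⊆image {u} R-split = (take a u , drop a u) , R-split , sym (take++drop≡id a u)

  Cube : ℕ → Word n → Set
  Cube k u = length u ≡ 3 * k × HasPeriod u k

  HasCount-Cube : ∀ {k} → 0 < k → HasCount (Cube {n} k) (n ^ k)
  HasCount-Cube {n} {k} 0<k = HasCount-cong (image⊆ , ⊆image) (HasCount-image (_^ʷ 3) injective (HasCount-words n k))
    where
    injective : ∀ {v w : Word n} → length v ≡ k → length w ≡ k → v ^ʷ 3 ≡ w ^ʷ 3 → v ≡ w
    injective {v} {w} |v|≡k |w|≡k eq = proj₁ (++-injective v w (trans |v|≡k (sym |w|≡k)) eq)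
    image⊆ : ∀ {u} → Image (_^ʷ 3) (λ v → length v ≡ k) u → Cube k u
    image⊆ (v , |v|≡k , refl) =
      trans (length-^ʷ v 3) (cong (3 *_) |v|≡k) , subst (HasPeriod (v ^ʷ 3)) |v|≡k (^ʷ-hasPeriod v 3)
    ⊆image : ∀ {u} → Cube k u → Image (_^ʷ 3) (λ v → length v ≡ k) u
    ⊆image {u} (|u|≡ , P) =
      take k u , length-take-≤ u (subst (k ≤_) (sym |u|≡) (m≤n*m k 3)) , hasPeriod⇒≡^ʷ u 3 {{>-nonZero 0<k}} |u|≡ P

  EpsWord : ℕ → Word n → Set
  EpsWord {n} l u = EpsPair n l (take (2 * l) u , drop (2 * l) u)

  Exceptional : ℕ → Word n → Set
  Exceptional l u = length u ≡ 3 * l × ¬ Primitive u × ¬ HasPeriod u l × ¬ Primitive (drop (2 * l) u)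

  module _ {n l : ℕ} (0<l : 0 < l) where

    private
      3l≡2l+l : 3 * l ≡ 2 * l + l
      3l≡2l+l = solve (l ∷ [])

      2l≤|u| : (u : Word n) → length u ≡ 3 * l → 2 * l ≤ length u
      2l≤|u| u |u|≡ = subst (2 * l ≤_) (sym (trans |u|≡ 3l≡2l+l)) (m≤m+n (2 * l) l)

      cube⇒¬primitive : ∀ {u} → Cube {n} l u → ¬ Primitive u
      cube⇒¬primitive (|u|≡ , P) = properPeriod⇒¬primitive (0<l , (1 , |u|≡) , P)

      cube⇒¬primitive-prefix : ∀ {u} → Cube l u → ¬ Primitive (take (2 * l) u)
      cube⇒¬primitive-prefix {u} (|u|≡ , P) =
        properPeriod⇒¬primitive (0<l , (0 , length-take-≤ u (2l≤|u| u |u|≡)) , take-hasPeriod⁺ u (2l≤|u| u |u|≡) P)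

    Classes-3l : Word n → Set
    Classes-3l = PrimOfLength n (3 * l) ∪ (EpsWord l ∪ (Cube l ∪ Exceptional l))

    classes-3l : Classes-3l ≐ (λ u → length u ≡ 3 * l)
    classes-3l = classes⊆ , ⊆classes
      where
      classes⊆ : ∀ {u} → Classes-3l u → length u ≡ 3 * l
      classes⊆     (inj₁ (|u|≡ , _))                          = |u|≡
      classes⊆ {u} (inj₂ (inj₁ ((|p|≡ , _) , (|q|≡ , _) , _))) =
        trans (length-take+drop u (2 * l)) (trans (cong₂ _+_ |p|≡ |q|≡) (sym 3l≡2l+l))
      classes⊆     (inj₂ (inj₂ (inj₁ (|u|≡ , _))))            = |u|≡
      classes⊆     (inj₂ (inj₂ (inj₂ (|u|≡ , _))))            = |u|≡

      ⊆classes : ∀ {u} → length u ≡ 3 * l → Classes-3l u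
      ⊆classes {u} |u|≡ with primitive? u | hasPeriod? Fin._≟_ u l | primitive? (drop (2 * l) u)
      ... | yes prim | _       | _         = inj₁ (|u|≡ , prim)
      ... | no ¬prim | yes per | _         = inj₂ (inj₂ (inj₁ (|u|≡ , per)))
      ... | no ¬prim | no ¬per | yes primq = inj₂ (inj₁
        ( (length-take-≤ u (2l≤|u| u |u|≡) , prefix-primitive |u|≡ 0<l ¬prim ¬per)
        , (length-drop-+ u (trans |u|≡ 3l≡2l+l) , primq)
        , subst (¬_ ∘ Primitive) (sym (take++drop≡id (2 * l) u)) ¬prim))
      ... | no ¬prim | no ¬per | no ¬primq = inj₂ (inj₂ (inj₂ (|u|≡ , ¬prim , ¬per , ¬primq)))

    cube∩exceptional : Empty (Cube {n} l ∩ Exceptional l)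
    cube∩exceptional _ ((_ , per) , (_ , _ , ¬per , _)) = ¬per per

    eps∩rest : Empty (EpsWord l ∩ (Cube l ∪ Exceptional l))
    eps∩rest _ (((_ , primp) , _) , inj₁ cube)                     = cube⇒¬primitive-prefix cube primp
    eps∩rest _ ((_ , (_ , primq) , _) , inj₂ (_ , _ , _ , ¬primq)) = ¬primq primq

    prim∩rest : Empty (PrimOfLength n (3 * l) ∩ (EpsWord l ∪ (Cube l ∪ Exceptional l)))
    prim∩rest u ((_ , prim) , inj₁ (_ , _ , ¬prim))        = subst (¬_ ∘ Primitive) (take++drop≡id (2 * l) u) ¬prim prim
    prim∩rest _ ((_ , prim) , inj₂ (inj₁ cube))            = cube⇒¬primitive cube prim
    prim∩rest _ ((_ , prim) , inj₂ (inj₂ (_ , ¬prim , _))) = ¬prim prim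

    words-of-length-3l : ∀ {π ε x} → HasCount (PrimOfLength n (3 * l)) π → HasCount (EpsPair n l) ε →
                         HasCount (Exceptional {n} l) x → n ^ (3 * l) ≡ π + (ε + (n ^ l + x))
    words-of-length-3l #π #ε #x =
      HasCount-unique (HasCount-words n (3 * l)) (HasCount-cong classes-3l
        (HasCount-∪ #π
          (HasCount-∪ (HasCount-split (2 * l) (proj₁ ∘ proj₁) #ε)
            (HasCount-∪ (HasCount-Cube 0<l) #x cube∩exceptional)
            eps∩rest)
          prim∩rest))

  -- The exceptional words

  exceptional-empty : ∀ {l} → 0 < l → ¬ 2 ∣ l → Empty (Exceptional {n} l)
  exceptional-empty {l = l} 0<l 2∤l u (|u|≡ , ¬prim , ¬per , ¬primq)
    with D , 2D≡3l , _ ← ¬primitive-suffix⇒square |u|≡ 0<l ¬prim ¬per ¬primq =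
    2∤l (∣m+n∣m⇒∣n (subst (2 ∣_) 3l≡2l+l (divides D (trans (sym 2D≡3l) (*-comm 2 D)))) (m∣m*n l))
    where
    3l≡2l+l : 3 * l ≡ 2 * l + l
    3l≡2l+l = solve (l ∷ [])

  ExceptionalRoot : ℕ → Word n → Set
  ExceptionalRoot h x = length x ≡ 3 * h × ¬ HasPeriod x h × ¬ Primitive (drop h x)

  drop-square : (x : Word n) {h : ℕ} → length x ≡ 3 * h → drop (2 * (2 * h)) (x ^ʷ 2) ≡ drop h x
  drop-square x {h} |x|≡ = begin
    drop (2 * (2 * h)) (x ++ (x ++ []))   ≡⟨ cong (λ k → drop k (x ++ (x ++ []))) 4h≡ ⟩
    drop (length x + h) (x ++ (x ++ []))  ≡⟨ drop-++ x (x ++ []) h ⟩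
    drop h (x ++ [])                      ≡⟨ cong (drop h) (++-identityʳ x) ⟩
    drop h x                              ∎
    where
    open ≡-Reasoning
    4h≡ : 2 * (2 * h) ≡ length x + h
    4h≡ = begin
      2 * (2 * h)   ≡⟨ solve (h ∷ []) ⟩
      3 * h + h     ≡⟨ cong (_+ h) (sym |x|≡) ⟩
      length x + h  ∎

  module _ {n h : ℕ} (0<h : 0 < h) where

    private
      0<3h : 0 < 3 * h
      0<3h = ≤-trans 0<h (m≤n*m h 3)

      6h≡ : 3 * (2 * h) ≡ 2 * (3 * h)
      6h≡ = solve (h ∷ [])

      3h≡2h+h : 3 * h ≡ 2 * h + h
      3h≡2h+h = solve (h ∷ [])

    square-exceptional : ∀ {x : Word n} → ExceptionalRoot h x → Exceptional (2 * h) (x ^ʷ 2)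
    square-exceptional {x} (|x|≡ , ¬perₓ , ¬primq) =
      trans |u|≡2*3h (sym 6h≡) ,
      properPeriod⇒¬primitive (0<3h , (0 , |u|≡2*3h) , P3h) ,
      ¬per2h ,
      subst (¬_ ∘ Primitive) (sym (drop-square x {h} |x|≡)) ¬primq
      where
      u = x ^ʷ 2
      |u|≡2*3h : length u ≡ 2 * (3 * h)
      |u|≡2*3h = trans (length-^ʷ x 2) (cong (2 *_) |x|≡)
      P3h : HasPeriod u (3 * h)
      P3h = subst (HasPeriod u) |x|≡ (^ʷ-hasPeriod x 2)
      5h≤ : 2 * h + 3 * h ≤ length u + 1
      5h≤ = begin
        2 * h + 3 * h             ≤⟨ m≤m+n (2 * h + 3 * h) (h + 1) ⟩
        2 * h + 3 * h + (h + 1)   ≡⟨ solve (h ∷ []) ⟩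
        2 * (3 * h) + 1           ≡⟨ cong (_+ 1) (sym |u|≡2*3h) ⟩
        length u + 1              ∎
        where open ≤-Reasoning
      |x|≤|u| : length x ≤ length u
      |x|≤|u| = subst (length x ≤_) (sym (length-^ʷ x 2)) (m≤m+n (length x) _)
      -- Fine and Wilf: the periods 2h and 3h of a word of length 6h force the period h.
      ¬per2h : ¬ HasPeriod u (2 * h)
      ¬per2h P2h = conclude (fine-wilf (≤-trans 0<h (m≤n*m h 2)) 0<3h (s≤s z≤n) (1∣ _) (1∣ _) 5h≤ P2h P3h)
        where
        conclude : CommonPeriod (at u) (length u) (2 * h) (3 * h) → _
        conclude (r , _ , r∣2h , r∣3h , Pᵣ) =
          ¬perₓ (subst (λ w → HasPeriod w h) (take-++ x (x ++ []))
                       (take-hasPeriod⁺ u |x|≤|u| (periodic-∣ r∣h Pᵣ)))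
          where
          r∣h = ∣m+n∣m⇒∣n (subst (r ∣_) 3h≡2h+h r∣3h) r∣2h

    exceptional⇒square : ∀ {u : Word n} → Exceptional (2 * h) u → Image (_^ʷ 2) (ExceptionalRoot h) u
    exceptional⇒square {u} (|u|≡ , ¬prim , ¬per , ¬primq)
      with D , 2D≡6h , PD ← ¬primitive-suffix⇒square |u|≡ (≤-trans 0<h (m≤n*m h 2)) ¬prim ¬per ¬primq =
      x , (|x|≡ , ¬perₓ , subst (¬_ ∘ Primitive) drop≡ ¬primq) , u≡x²
      where
      x = take (3 * h) u
      |u|≡2*3h : length u ≡ 2 * (3 * h)
      |u|≡2*3h = trans |u|≡ 6h≡
      3h≤|u| : 3 * h ≤ length u
      3h≤|u| = subst (3 * h ≤_) (sym |u|≡2*3h) (m≤n*m (3 * h) 2)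
      P3h : HasPeriod u (3 * h)
      P3h = subst (HasPeriod u) (*-cancelˡ-≡ D (3 * h) 2 (trans 2D≡6h 6h≡)) PD
      u≡x² : u ≡ x ^ʷ 2
      u≡x² = hasPeriod⇒≡^ʷ u 2 {{>-nonZero 0<3h}} |u|≡2*3h P3h
      |x|≡ : length x ≡ 3 * h
      |x|≡ = length-take-≤ u 3h≤|u|
      drop≡ : drop (2 * (2 * h)) u ≡ drop h x
      drop≡ = trans (cong (drop (2 * (2 * h))) u≡x²) (drop-square x {h} |x|≡)
      ¬perₓ : ¬ HasPeriod x h
      ¬perₓ Pₓ = ¬per (periodic-∣ (n∣m*n 2)
        (periodic-lift 0 {{>-nonZero 0<3h}} {{>-nonZero 0<h}} (n∣m*n 3) ≤-refl 3h≤|u| P3h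
          (take-hasPeriod⁻ u 3h≤|u| Pₓ)))

    HasCount-Exceptional : ∀ {N} → HasCount (ExceptionalRoot {n} h) N → HasCount (Exceptional {n} (2 * h)) N
    HasCount-Exceptional =
      HasCount-cong ((λ { (x , root , refl) → square-exceptional root }) , exceptional⇒square)
      ∘ HasCount-image (_^ʷ 2) injective
      where
      injective : ∀ {x y} → ExceptionalRoot h x → ExceptionalRoot h y → x ^ʷ 2 ≡ y ^ʷ 2 → x ≡ y
      injective {x} {y} (|x|≡ , _) (|y|≡ , _) eq = proj₁ (++-injective x y (trans |x|≡ (sym |y|≡)) eq)

    PrimitiveTail : Word n → Set
    PrimitiveTail u = length (take h u) ≡ h × PrimOfLength n (2 * h) (drop h u)

    private
      3h≡h+2h : 3 * h ≡ h + 2 * h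
      3h≡h+2h = solve (h ∷ [])

      h≤|u| : (u : Word n) → length u ≡ 3 * h → h ≤ length u
      h≤|u| u |u|≡ = subst (h ≤_) (sym (trans |u|≡ 3h≡h+2h)) (m≤m+n h (2 * h))

    Classes-3h : Word n → Set
    Classes-3h = PrimitiveTail ∪ (Cube h ∪ ExceptionalRoot h)

    classes-3h : Classes-3h ≐ (λ u → length u ≡ 3 * h)
    classes-3h = classes⊆ , ⊆classes
      where
      classes⊆ : ∀ {u} → Classes-3h u → length u ≡ 3 * h
      classes⊆ {u} (inj₁ (|p|≡ , |q|≡ , _)) =
        trans (length-take+drop u h) (trans (cong₂ _+_ |p|≡ |q|≡) (sym 3h≡h+2h))
      classes⊆     (inj₂ (inj₁ (|u|≡ , _))) = |u|≡
      classes⊆     (inj₂ (inj₂ (|u|≡ , _))) = |u|≡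

      ⊆classes : ∀ {u} → length u ≡ 3 * h → Classes-3h u
      ⊆classes {u} |u|≡ with primitive? (drop h u) | hasPeriod? Fin._≟_ u h
      ... | yes primq | _       =
        inj₁ (length-take-≤ u (h≤|u| u |u|≡) , length-drop-+ u {h} (trans |u|≡ 3h≡h+2h) , primq)
      ... | no ¬primq | yes per = inj₂ (inj₁ (|u|≡ , per))
      ... | no ¬primq | no ¬per = inj₂ (inj₂ (|u|≡ , ¬per , ¬primq))

    cube∩root : Empty (Cube {n} h ∩ ExceptionalRoot h)
    cube∩root _ ((_ , per) , (_ , ¬per , _)) = ¬per per

    tail∩rest : Empty (PrimitiveTail ∩ (Cube h ∪ ExceptionalRoot h))
    tail∩rest u ((_ , |q|≡ , primq) , inj₁ (|u|≡ , per)) =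
      properPeriod⇒¬primitive (0<h , (0 , |q|≡) , drop-hasPeriod⁺ u (h≤|u| u |u|≡) per) primq
    tail∩rest _ ((_ , _ , primq) , inj₂ (_ , _ , ¬primq)) = ¬primq primq

    words-of-length-3h : ∀ {π N} → HasCount (PrimOfLength n (2 * h)) π → HasCount (ExceptionalRoot {n} h) N →
                         n ^ (3 * h) ≡ n ^ h * π + (n ^ h + N)
    words-of-length-3h #π #roots =
      HasCount-unique (HasCount-words n (3 * h)) (HasCount-cong classes-3h
        (HasCount-∪ (HasCount-split h proj₁ (HasCount-× (HasCount-words n h) #π))
          (HasCount-∪ (HasCount-Cube 0<h) #roots cube∩root)
          tail∩rest))

  2∣3^m*x⇒2∣x : ∀ m {x} → 2 ∣ 3 ^ m * x → 2 ∣ x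
  2∣3^m*x⇒2∣x zero    {x} 2∣x+0 = subst (2 ∣_) (+-identityʳ x) 2∣x+0
  2∣3^m*x⇒2∣x (suc m) {x} 2∣3*3^m*x =
    2∣3^m*x⇒2∣x m (coprime-divisor (gcd≡1⇒coprime {2} {3} refl) (subst (2 ∣_) (*-assoc 3 (3 ^ m) x) 2∣3*3^m*x))

  count-odd : ∀ {n l π ε} → 0 < l → ¬ 2 ∣ l → HasCount (PrimOfLength n (3 * l)) π → HasCount (EpsPair n l) ε →
              n ^ (3 * l) ≡ π + (ε + n ^ l)
  count-odd {n} {l} {π} {ε} 0<l 2∤l #π #ε =
    trans (words-of-length-3l 0<l #π #ε (HasCount-∅ (exceptional-empty 0<l 2∤l)))
          (cong (λ x → π + (ε + x)) (+-identityʳ (n ^ l)))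

  count-even : ∀ {n l h π3l πl ε} → l ≡ 2 * h → 0 < l →
               HasCount (PrimOfLength n (3 * l)) π3l → HasCount (PrimOfLength n l) πl → HasCount (EpsPair n l) ε →
               ∃[ N ] n ^ (3 * l) ≡ π3l + (ε + (n ^ l + N)) × n ^ (3 * l / 2) ≡ n ^ (l / 2) * πl + (n ^ (l / 2) + N)
  count-even {n} {h = h} {πl = π₂} refl 0<2h #π₆ #π₂ #ε
    with N , #roots ← HasCount-∩ (HasCount-words n (3 * h))
                        (λ x → ¬? (hasPeriod? Fin._≟_ x h) ×-dec ¬? (primitive? (drop h x)))
    = N , words-of-length-3l 0<2h #π₆ #ε (HasCount-Exceptional 0<h #roots) ,
      subst₂ (λ a b → n ^ a ≡ n ^ b * π₂ + (n ^ b + N)) (sym 6h/2≡3h) (sym 2h/2≡h)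
        (words-of-length-3h 0<h #π₂ #roots)
    where
    0<h : 0 < h
    0<h = >-nonZero⁻¹ h {{m*n≢0⇒n≢0 2 {{>-nonZero 0<2h}}}}
    2h/2≡h : 2 * h / 2 ≡ h
    2h/2≡h = trans (cong (_/ 2) (*-comm 2 h)) (m*n/n≡m h 2)
    6h/2≡3h : 3 * (2 * h) / 2 ≡ 3 * h
    6h/2≡3h = trans (cong (_/ 2) (trans (cong (3 *_) (*-comm 2 h)) (sym (*-assoc 3 h 2)))) (m*n/n≡m (3 * h) 2)

open import Defs
open import Data.Nat using (ℕ; _≤_; _*_; _^_; _/_)
open import Data.Nat.Divisibility using (_∣_)
open import Data.Nat.GCD using (gcd)
open import Data.Integer using (ℤ; +_; _+_; _-_) renaming (_*_ to _*ℤ_)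
open import Relation.Binary.PropositionalEquality using (_≡_)
open import Relation.Nullary using (¬_)
open import Data.Product using (_×_)

import Data.Nat as ℕ
import Data.Nat.Properties as ℕₚ
open import Data.Nat.Divisibility using (divides)
open import Data.Integer.Properties using (pos-+; pos-*)
open import Data.Integer.Tactic.RingSolver using (solve-∀)
open import Data.Product using (_,_)
open import Function using (_∘_)
open import Relation.Binary.PropositionalEquality using (refl; sym; trans; cong; cong₂; subst; module ≡-Reasoning)
open WordCounting using (count-odd; count-even; 2∣3^m*x⇒2∣x)

private
  +-homomorphic₃ : ∀ a b c → + (a ℕ.+ (b ℕ.+ c)) ≡ + a + (+ b + + c)
  +-homomorphic₃ a b c = trans (pos-+ a (b ℕ.+ c)) (cong (_+_ (+ a)) (pos-+ b c))

  ε-from-odd-count : ∀ {N P E V} → N ≡ P ℕ.+ (E ℕ.+ V) → + E ≡ (+ N - + V) - + P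
  ε-from-odd-count {N} {P} {E} {V} refl = begin
    + E                                     ≡⟨ ring (+ P) (+ E) (+ V) ⟩
    (+ P + (+ E + + V) - + V) - + P         ≡⟨ cong (λ z → (z - + V) - + P) (sym (+-homomorphic₃ P E V)) ⟩
    (+ (P ℕ.+ (E ℕ.+ V)) - + V) - + P       ∎
    where
    open ≡-Reasoning
    ring : ∀ p e v → e ≡ (p + (e + v) - v) - p
    ring = solve-∀

  ε-from-even-counts : ∀ {N₆ N₃ P E V H Q X} → N₆ ≡ P ℕ.+ (E ℕ.+ (V ℕ.+ X)) → N₃ ≡ H ℕ.* Q ℕ.+ (H ℕ.+ X) →
                       + E ≡ (((+ N₆ + (+ H *ℤ (+ Q + + 1))) - + V) - + P) - + N₃
  ε-from-even-counts {P = P} {E} {V} {H} {Q} {X} refl refl = begin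
    + E
      ≡⟨ ring (+ P) (+ E) (+ V) (+ H) (+ Q) (+ X) ⟩
    (((+ P + (+ E + (+ V + + X)) + (+ H *ℤ (+ Q + + 1))) - + V) - + P) - (+ H *ℤ + Q + (+ H + + X))
      ≡⟨ cong₂ (λ a b → (((a + (+ H *ℤ (+ Q + + 1))) - + V) - + P) - b)
               (sym (trans (pos-+ P _) (cong (_+_ (+ P)) (+-homomorphic₃ E V X))))
               (sym (trans (pos-+ (H ℕ.* Q) _) (cong₂ _+_ (pos-* H Q) (pos-+ H X)))) ⟩
    (((+ (P ℕ.+ (E ℕ.+ (V ℕ.+ X))) + (+ H *ℤ (+ Q + + 1))) - + V) - + P) - + (H ℕ.* Q ℕ.+ (H ℕ.+ X))
      ∎
    where
    open ≡-Reasoning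
    ring : ∀ p e v h q x → e ≡ (((p + (e + (v + x)) + (h *ℤ (q + + 1))) - v) - p) - (h *ℤ q + (h + x))
    ring = solve-∀

epsilon-odd : ∀ {n l π3l ε} → 0 ℕ.< l → ¬ (2 ∣ l) →
              HasCount (PrimOfLength n (3 * l)) π3l → HasCount (EpsPair n l) ε →
              + ε ≡ (+ (n ^ (3 * l)) - + (n ^ l)) - + π3l
epsilon-odd {n} {l} {π3l} {ε} 0<l 2∤l #π3l #ε = ε-from-odd-count {P = π3l} {ε} {n ^ l} (count-odd 0<l 2∤l #π3l #ε)

epsilon-even : ∀ {n l h π3l πl ε} → l ≡ 2 * h → 0 ℕ.< l →
               HasCount (PrimOfLength n (3 * l)) π3l → HasCount (PrimOfLength n l) πl → HasCount (EpsPair n l) ε →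
               + ε ≡ (((+ (n ^ (3 * l)) + (+ (n ^ (l / 2)) *ℤ (+ πl + + 1))) - + (n ^ l)) - + π3l) - + (n ^ ((3 * l) / 2))
epsilon-even {n} {l} {h} {π3l} {πl} {ε} l≡2h 0<l #π3l #πl #ε
  with N , count₆ , count₃ ← count-even {h = h} l≡2h 0<l #π3l #πl #ε =
  ε-from-even-counts {P = π3l} {ε} {n ^ l} {n ^ (l / 2)} {πl} {N} count₆ count₃

-- Only l > 0 and the parity of l (that of l₁) matter.
theorem3p12 : (n l m l₁ : ℕ) → 2 ≤ n → l ≡ (3 ^ m) * l₁ → 2 ≤ l₁ → gcd 3 l₁ ≡ 1 →
  (π3l πl ε : ℕ) →
  HasCount (PrimOfLength n (3 * l)) π3l → HasCount (PrimOfLength n l) πl → HasCount (EpsPair n l) ε →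
  ((¬ (2 ∣ l₁)) → + ε ≡ (+ (n ^ (3 * l)) - + (n ^ l)) - + π3l) ×
  ((2 ∣ l₁) → + ε ≡ (((+ (n ^ (3 * l)) + (+ (n ^ (l / 2)) *ℤ (+ πl + + 1))) - + (n ^ l)) - + π3l) - + (n ^ ((3 * l) / 2)))
theorem3p12 n l m l₁ _ l≡3ᵐl₁ 2≤l₁ _ π3l πl ε #π3l #πl #ε =
  (λ 2∤l₁ → epsilon-odd 0<l (2∤l₁ ∘ 2∣3^m*x⇒2∣x m ∘ subst (2 ∣_) l≡3ᵐl₁) #π3l #ε) ,
  (λ { (divides j refl) → epsilon-even {h = 3 ^ m * j} (trans l≡3ᵐl₁ (3ᵐ[j*2]≡2[3ᵐj] j)) 0<l #π3l #πl #ε })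
  where
  0<l : 0 ℕ.< l
  0<l = subst (0 ℕ.<_) (sym l≡3ᵐl₁) (ℕₚ.*-mono-≤ (ℕₚ.m^n>0 3 m) (ℕₚ.≤-trans (ℕ.s≤s ℕ.z≤n) 2≤l₁))
  3ᵐ[j*2]≡2[3ᵐj] : ∀ j → 3 ^ m * (j * 2) ≡ 2 * (3 ^ m * j)
  3ᵐ[j*2]≡2[3ᵐj] j = trans (sym (ℕₚ.*-assoc (3 ^ m) j 2)) (ℕₚ.*-comm (3 ^ m * j) 2)
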